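{- Let $A=(a_{ij})\in\mathbb{R}^{n\times n}$ be a real (symmetric) positive semidefinite matrix. Fix $i\in\{1,\dots,n\}$ and assume \[ \operatorname{per}(A\circ A)\le \operatorname{per}(A)^2 \quad\text{and}\quad \operatorname{per}\bigl(A(i)\circ A(i)\bigr)\le \operatorname{per}\bigl(A(i)\bigr)^2. \] Let $\alpha\ge 0$ and $A':=A+\alpha E_{ii}$. Then $\operatorname{per}(A'\circ A')\le \operatorname{per}(A')^2$.
   Context: $\operatorname{per}$ is the permanent and $\circ$ the Hadamard (entrywise) product. $A(i)$ is the principal submatrix of $A$ obtained by deleting row $i$ and column $i$. $E_{ii}$ is the matrix with a $1$ in entry $(i,i)$ and zeros elsewhere. -}

module Defs where

open import Level using (0ℓ)
open import Data.Nat using (ℕ; zero; suc)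
open import Data.Fin using (Fin; zero; suc; punchIn; _≟_)
open import Data.Product using (Σ; ∃; _×_)
open import Relation.Nullary using (¬_; yes; no)
open import Relation.Binary.PropositionalEquality using (_≡_)
open import Relation.Binary.Structures using (IsTotalOrder)
open import Algebra.Structures using (IsCommutativeRing)

-- The real numbers, axiomatised as a (Dedekind-)complete ordered field.
-- Any two such structures are isomorphic, so quantifying over all of them
-- is the same as speaking about ℝ.
record RealField : Set₁ where
  infixl 6 _+_
  infixl 7 _*_
  infix  4 _≤_
  field
    Carrier : Set
    _+_ _*_ : Carrier → Carrier → Carrier
    -_      : Carrier → Carrier
    0# 1#   : Carrier
    _≤_     : Carrier → Carrier → Set
    isCommutativeRing : IsCommutativeRing _≡_ _+_ _*_ -_ 0# 1#
    0≢1     : ¬ (0# ≡ 1#)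
    inverse : ∀ x → ¬ (x ≡ 0#) → ∃ λ y → x * y ≡ 1#
    isTotalOrder : IsTotalOrder _≡_ _≤_
    +-mono-≤ : ∀ {x y} z → x ≤ y → x + z ≤ y + z
    *-nonneg : ∀ {x y} → 0# ≤ x → 0# ≤ y → 0# ≤ x * y
    sup : (S : Carrier → Set) → ∃ S → (∃ λ b → ∀ x → S x → x ≤ b) →
          ∃ λ s → (∀ x → S x → x ≤ s) × (∀ b → (∀ x → S x → x ≤ b) → s ≤ b)

module _ (ℝ : RealField) where
  open RealField ℝ

  Matrix : ℕ → Set
  Matrix n = Fin n → Fin n → Carrier

  Σ[_] : (n : ℕ) → (Fin n → Carrier) → Carrier
  Σ[ zero ] f = 0#
  Σ[ suc n ] f = f zero + Σ[ n ] (λ j → f (suc j))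

  per : ∀ {n} → Matrix n → Carrier
  per {zero} A = 1#
  per {suc n} A = Σ[ suc n ] (λ j → A zero j * per (λ r c → A (suc r) (punchIn j c)))

  _∘ₕ_ : ∀ {n} → Matrix n → Matrix n → Matrix n
  (A ∘ₕ B) r c = A r c * B r c

  _² : Carrier → Carrier
  x ² = x * x

  Symmetric : ∀ {n} → Matrix n → Set
  Symmetric A = ∀ r c → A r c ≡ A c r

  PosSemidef : ∀ {n} → Matrix n → Set
  PosSemidef {n} A = Symmetric A ×
    (∀ (x : Fin n → Carrier) → 0# ≤ Σ[ n ] (λ r → Σ[ n ] (λ c → x r * A r c * x c)))

  delete : ∀ {n} → Fin (suc n) → Matrix (suc n) → Matrix n
  delete i A r c = A (punchIn i r) (punchIn i c)

  E : ∀ {n} → Fin n → Matrix n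
  E i r c with r ≟ i | c ≟ i
  ... | yes _ | yes _ = 1#
  ... | _     | _     = 0#

  _+ₘ_ : ∀ {n} → Matrix n → Matrix n → Matrix n
  (A +ₘ B) r c = A r c + B r c

  _·ₘ_ : ∀ {n} → Carrier → Matrix n → Matrix n
  (α ·ₘ B) r c = α * B r c

-- Write P = per A, p = per A(i), a = a_ii and β = 2αa + α². Expanding along row i,
-- per (B + βE_ii) = per B + β per B(i), and A′ ∘ A′ = A ∘ A + βE_ii, so
--   per (A′ ∘ A′) = per (A ∘ A) + β per (A(i) ∘ A(i)) ≤ P² + βp² ≤ P² + 2αpP + α²p² = per (A′)²,
-- where the middle step is Lieb's inequality a p ≤ P. Expanding per A along row i, the
-- off-diagonal part of P is the quadratic form of a_i· against the matrix of permanents of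
-- submatrices of A; that matrix is positive semidefinite by induction on the size of the
-- submatrices, each step being an instance of the Schur product theorem. The Schur product
-- theorem itself is proved by eliminating the pivot of A + εE₀₀ and letting ε → 0.
module Submission where

open import Defs
open import Level using (0ℓ)
open import Data.Nat using (ℕ; zero; suc)
open import Data.Fin using (Fin; zero; suc; punchIn; punchOut; _≟_)
open import Data.Fin.Properties using (punchInᵢ≢i; punchOut-punchIn; punchOut-cong; punchIn-punchOut)
open import Data.Product using (∃; _×_; _,_; proj₁; proj₂)
open import Data.Sum using (inj₁; inj₂)
open import Data.Empty using (⊥-elim)
open import Data.Unit using (tt)
open import Data.List using (List; []; _∷_; _++_; map; tabulate; allFin; cartesianProduct)
open import Relation.Nullary using (¬_; yes; no)
open import Relation.Binary.PropositionalEquality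
open import Relation.Binary.Structures using (IsTotalOrder)
open import Algebra.Bundles using (CommutativeRing)
open import Algebra.Structures using (IsCommutativeRing)
open import Function using (_∘_; id)

module PermanentTheory (ℝ : RealField) where
  open RealField ℝ renaming (+-mono-≤ to +-monoˡ-≤)
  open IsCommutativeRing isCommutativeRing
    using (+-assoc; +-comm; +-identityˡ; +-identityʳ; *-assoc; *-comm; *-identityˡ; *-identityʳ;
           distribˡ; distribʳ; zeroˡ; zeroʳ; -‿inverseˡ; -‿inverseʳ)
  open IsTotalOrder isTotalOrder using (total; antisym) renaming (refl to ≤-refl; trans to ≤-trans)

  commutativeRing : CommutativeRing 0ℓ 0ℓ
  commutativeRing = record { isCommutativeRing = isCommutativeRing }

  open CommutativeRing commutativeRing using (ring; semiring; commutativeSemiring)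
  open import Algebra.Properties.Ring ring using (-‿distribˡ-*; -‿distribʳ-*; -‿involutive; -‿+-comm; +-cancelʳ)
  open import Algebra.Properties.Semiring.Mult semiring using (×-assoc-*) renaming (_×_ to _·_)
  open import Algebra.Properties.Semiring.Sum semiring
    using (sum; sum-syntax; sum-cong-≗; ∑-distrib-+; ∑-comm; *-distribˡ-sum; *-distribʳ-sum; sum-remove; sum-replicate; sum-replicate-zero)
  open import Algebra.Solver.Ring.NaturalCoefficients.Default commutativeSemiring
  open ≡-Reasoning

  private
    variable
      X Y : Set

  -- Ordered fields

  infixl 6 _-_
  _-_ : Carrier → Carrier → Carrier
  x - y = x + - y

  ≤-reflexive : ∀ {x y} → x ≡ y → x ≤ y
  ≤-reflexive refl = ≤-refl

  +-monoʳ-≤ : ∀ z {x y} → x ≤ y → z + x ≤ z + y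
  +-monoʳ-≤ z {x} {y} x≤y = subst₂ _≤_ (+-comm x z) (+-comm y z) (+-monoˡ-≤ z x≤y)

  +-mono-≤ : ∀ {a b c d} → a ≤ b → c ≤ d → a + c ≤ b + d
  +-mono-≤ {b = b} {c} a≤b c≤d = ≤-trans (+-monoˡ-≤ c a≤b) (+-monoʳ-≤ b c≤d)

  +-nonneg : ∀ {x y} → 0# ≤ x → 0# ≤ y → 0# ≤ x + y
  +-nonneg 0≤x 0≤y = subst (_≤ _) (+-identityˡ 0#) (+-mono-≤ 0≤x 0≤y)

  x≤y⇒0≤y-x : ∀ {x y} → x ≤ y → 0# ≤ y - x
  x≤y⇒0≤y-x {x} x≤y = subst (_≤ _) (-‿inverseʳ x) (+-monoˡ-≤ (- x) x≤y)

  x-y+y≡x : ∀ x y → x - y + y ≡ x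
  x-y+y≡x x y = trans (+-assoc x (- y) y) (trans (cong (x +_) (-‿inverseˡ y)) (+-identityʳ x))

  0≤y-x⇒x≤y : ∀ {x y} → 0# ≤ y - x → x ≤ y
  0≤y-x⇒x≤y {x} {y} 0≤y-x = subst₂ _≤_ (+-identityˡ x) (x-y+y≡x y x) (+-monoˡ-≤ x 0≤y-x)

  x≤0⇒0≤-x : ∀ {x} → x ≤ 0# → 0# ≤ - x
  x≤0⇒0≤-x {x} x≤0 = subst (0# ≤_) (+-identityˡ (- x)) (x≤y⇒0≤y-x x≤0)

  0≤-x⇒x≤0 : ∀ {x} → 0# ≤ - x → x ≤ 0#
  0≤-x⇒x≤0 {x} 0≤-x = 0≤y-x⇒x≤y (subst (0# ≤_) (sym (+-identityˡ (- x))) 0≤-x)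

  *-monoʳ-≤-nonneg : ∀ {c x y} → 0# ≤ c → x ≤ y → c * x ≤ c * y
  *-monoʳ-≤-nonneg {c} {x} {y} 0≤c x≤y = 0≤y-x⇒x≤y (subst (0# ≤_) c[y-x]≡cy-cx (*-nonneg 0≤c (x≤y⇒0≤y-x x≤y)))
    where
    c[y-x]≡cy-cx : c * (y - x) ≡ c * y - c * x
    c[y-x]≡cy-cx = trans (distribˡ c y (- x)) (cong (c * y +_) (sym (-‿distribʳ-* c x)))

  *-nonpos-nonneg : ∀ {x y} → x ≤ 0# → 0# ≤ y → y * x ≤ 0#
  *-nonpos-nonneg {x} {y} x≤0 0≤y = 0≤-x⇒x≤0 (subst (0# ≤_) (sym (-‿distribʳ-* y x)) (*-nonneg 0≤y (x≤0⇒0≤-x x≤0)))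

  square-nonneg : ∀ x → 0# ≤ x * x
  square-nonneg x with total 0# x
  ... | inj₁ 0≤x = *-nonneg 0≤x 0≤x
  ... | inj₂ x≤0 = subst (0# ≤_) -x*-x≡x*x (*-nonneg (x≤0⇒0≤-x x≤0) (x≤0⇒0≤-x x≤0))
    where
    -x*-x≡x*x : - x * - x ≡ x * x
    -x*-x≡x*x = trans (sym (-‿distribˡ-* x (- x))) (trans (cong -_ (sym (-‿distribʳ-* x x))) (-‿involutive (x * x)))

  0≤1 : 0# ≤ 1#
  0≤1 = subst (0# ≤_) (*-identityˡ 1#) (square-nonneg 1#)

  *-cancelˡ : ∀ {q x y} → ¬ q ≡ 0# → q * x ≡ q * y → x ≡ y
  *-cancelˡ {q} {x} {y} q≢0 qx≡qy = begin
      x                 ≡⟨ sym (trans (cong (_* x) q⁻¹q≡1) (*-identityˡ x)) ⟩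
      q⁻¹ * q * x       ≡⟨ *-assoc q⁻¹ q x ⟩
      q⁻¹ * (q * x)     ≡⟨ cong (q⁻¹ *_) qx≡qy ⟩
      q⁻¹ * (q * y)     ≡⟨ sym (*-assoc q⁻¹ q y) ⟩
      q⁻¹ * q * y       ≡⟨ trans (cong (_* y) q⁻¹q≡1) (*-identityˡ y) ⟩
      y                 ∎
    where
    q⁻¹ = proj₁ (inverse q q≢0)
    q⁻¹q≡1 : q⁻¹ * q ≡ 1#
    q⁻¹q≡1 = trans (*-comm q⁻¹ q) (proj₂ (inverse q q≢0))

  *-nonneg-cancelˡ : ∀ {q y} → 0# ≤ q → ¬ q ≡ 0# → 0# ≤ q * y → 0# ≤ y
  *-nonneg-cancelˡ {q} {y} 0≤q q≢0 0≤qy with total 0# y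
  ... | inj₁ 0≤y = 0≤y
  ... | inj₂ y≤0 = ≤-reflexive (sym (*-cancelˡ q≢0 (trans qy≡0 (sym (zeroʳ q)))))
    where
    qy≡0 : q * y ≡ 0#
    qy≡0 = antisym (*-nonpos-nonneg y≤0 0≤q) 0≤qy

  x+y-x≡y : ∀ x y → x + y - x ≡ y
  x+y-x≡y x y = begin
    x + y - x      ≡⟨ solve 3 (λ x y z → x :+ y :+ z := y :+ (x :+ z)) refl x y (- x) ⟩
    y + (x - x)    ≡⟨ cong (y +_) (-‿inverseʳ x) ⟩
    y + 0#         ≡⟨ +-identityʳ y ⟩
    y              ∎

  ·-nonneg : ∀ n {x} → 0# ≤ x → 0# ≤ n · x
  ·-nonneg zero    0≤x = ≤-refl
  ·-nonneg (suc n) 0≤x = +-nonneg 0≤x (·-nonneg n 0≤x)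

  ·≡·1* : ∀ n x → n · x ≡ (n · 1#) * x
  ·≡·1* n x = sym (trans (×-assoc-* n 1# x) (cong (n ·_) (*-identityˡ x)))

  suc·1≢0 : ∀ n → ¬ suc n · 1# ≡ 0#
  suc·1≢0 n 1+n≡0 = 0≢1 (antisym 0≤1 (subst (1# ≤_) 1+n≡0 1≤1+n))
    where
    1≤1+n : 1# ≤ suc n · 1#
    1≤1+n = subst (_≤ suc n · 1#) (+-identityʳ 1#) (+-monoʳ-≤ 1# (·-nonneg n 0≤1))

  ·-cancel : ∀ n {x y} → suc n · x ≡ suc n · y → x ≡ y
  ·-cancel n {x} {y} eq = *-cancelˡ (suc·1≢0 n) (trans (sym (·≡·1* (suc n) x)) (trans eq (·≡·1* (suc n) y)))

  -- The supremum s of {(n+1)·y} satisfies s ≤ s - y, because (n+2)·y = y + (n+1)·y.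
  archimedean : ∀ y b → (∀ n → suc n · y ≤ b) → y ≤ 0#
  archimedean y b bounded = 0≤-x⇒x≤0 (subst (0# ≤_) s-y-s≡-y (x≤y⇒0≤y-x s≤s-y))
    where
    Multiple : Carrier → Set
    Multiple z = ∃ λ n → z ≡ suc n · y
    supremum = sup Multiple (1 · y , 0 , refl) (b , λ { _ (n , refl) → bounded n })
    s = proj₁ supremum
    s-y-bounds : ∀ z → Multiple z → z ≤ s - y
    s-y-bounds _ (n , refl) = 0≤y-x⇒x≤y (subst (0# ≤_) s-[y+ny]≡s-y-ny (x≤y⇒0≤y-x (proj₁ (proj₂ supremum) _ (suc n , refl))))
      where
      s-[y+ny]≡s-y-ny : s - (y + suc n · y) ≡ s - y - suc n · y
      s-[y+ny]≡s-y-ny = trans (cong (s +_) (sym (-‿+-comm y _))) (sym (+-assoc s (- y) _))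
    s≤s-y : s ≤ s - y
    s≤s-y = proj₂ (proj₂ supremum) (s - y) s-y-bounds
    s-y-s≡-y : s - y - s ≡ - y
    s-y-s≡-y = x+y-x≡y s (- y)

  nonneg-by-perturbation : ∀ x r → (∀ ε → 0# ≤ ε → ¬ ε ≡ 0# → 0# ≤ x + ε * r) → 0# ≤ x
  nonneg-by-perturbation x r perturbed = subst (0# ≤_) (-‿involutive x) (x≤0⇒0≤-x (archimedean (- x) r bounded))
    where
    bounded : ∀ n → suc n · (- x) ≤ r
    bounded n = 0≤y-x⇒x≤y (subst (0# ≤_) m[x+εr]≡r-m[-x] (*-nonneg 0≤m (perturbed ε 0≤ε ε≢0)))
      where
      m = suc n · 1#
      ε = proj₁ (inverse m (suc·1≢0 n))
      mε≡1 : m * ε ≡ 1#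
      mε≡1 = proj₂ (inverse m (suc·1≢0 n))
      0≤m : 0# ≤ m
      0≤m = ·-nonneg (suc n) 0≤1
      0≤ε : 0# ≤ ε
      0≤ε with total 0# ε
      ... | inj₁ 0≤ε = 0≤ε
      ... | inj₂ ε≤0 = ⊥-elim (0≢1 (antisym 0≤1 (subst (_≤ 0#) mε≡1 (*-nonpos-nonneg ε≤0 0≤m))))
      ε≢0 : ¬ ε ≡ 0#
      ε≢0 ε≡0 = 0≢1 (trans (sym (zeroʳ m)) (trans (cong (m *_) (sym ε≡0)) mε≡1))
      m[x+εr]≡r-m[-x] : m * (x + ε * r) ≡ r - suc n · (- x)
      m[x+εr]≡r-m[-x] = begin
        m * (x + ε * r)     ≡⟨ solve 4 (λ m x ε r → m :* (x :+ ε :* r) := m :* x :+ m :* ε :* r) refl m x ε r ⟩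
        m * x + m * ε * r   ≡⟨ cong (λ t → m * x + t * r) mε≡1 ⟩
        m * x + 1# * r      ≡⟨ solve 2 (λ mx r → mx :+ con 1 :* r := r :+ mx) refl (m * x) r ⟩
        r + m * x           ≡⟨ cong (r +_) (sym (-‿involutive (m * x))) ⟩
        r - - (m * x)       ≡⟨ cong (λ t → r - t) (-‿distribʳ-* m x) ⟩
        r - m * - x         ≡⟨ cong (λ t → r - t) (sym (·≡·1* (suc n) (- x))) ⟩
        r - suc n · (- x)   ∎

  shifted-square-bound : ∀ {α a p P X Y} → 0# ≤ α → 0# ≤ a → 0# ≤ p → a * p ≤ P → X ≤ P * P → Y ≤ p * p →
    X + ((α + α) * a + α * α) * Y ≤ (P + α * p) * (P + α * p)
  shifted-square-bound {α} {a} {p} {P} 0≤α 0≤a 0≤p ap≤P X≤PP Y≤pp =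
    ≤-trans (+-mono-≤ X≤PP (*-monoʳ-≤-nonneg 0≤β Y≤pp))
            (subst₂ _≤_ (cong (P * P +_) (sym βpp≡)) square
                    (+-monoʳ-≤ (P * P) (+-monoˡ-≤ (α * α * (p * p)) (*-monoʳ-≤-nonneg 0≤2αp ap≤P))))
    where
    0≤β : 0# ≤ (α + α) * a + α * α
    0≤β = +-nonneg (*-nonneg (+-nonneg 0≤α 0≤α) 0≤a) (*-nonneg 0≤α 0≤α)
    0≤2αp : 0# ≤ (α + α) * p
    0≤2αp = *-nonneg (+-nonneg 0≤α 0≤α) 0≤p
    βpp≡ : ((α + α) * a + α * α) * (p * p) ≡ (α + α) * p * (a * p) + α * α * (p * p)
    βpp≡ = solve 3 (λ α a p → ((α :+ α) :* a :+ α :* α) :* (p :* p) := (α :+ α) :* p :* (a :* p) :+ α :* α :* (p :* p)) refl α a p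
    square : P * P + ((α + α) * p * P + α * α * (p * p)) ≡ (P + α * p) * (P + α * p)
    square = solve 3 (λ P α p → P :* P :+ ((α :+ α) :* p :* P :+ α :* α :* (p :* p)) := (P :+ α :* p) :* (P :+ α :* p)) refl P α p

  -- Laplace expansion of the permanent

  Σ≡sum : ∀ n (f : Fin n → Carrier) → Σ[_] ℝ n f ≡ sum f
  Σ≡sum zero    f = refl
  Σ≡sum (suc n) f = cong (f zero +_) (Σ≡sum n (f ∘ suc))

  sum-sift : ∀ {n} (f : Fin n → Carrier) (u : Fin n) → (∀ j → ¬ j ≡ u → f j ≡ 0#) → sum f ≡ f u
  sum-sift {suc n} f u vanishes = begin
    sum f                            ≡⟨ sum-remove {i = u} f ⟩
    f u + sum (f ∘ punchIn u)        ≡⟨ cong (f u +_) (sum-cong-≗ (λ c → vanishes _ (punchInᵢ≢i u c))) ⟩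
    f u + sum {n} (λ _ → 0#)         ≡⟨ cong (f u +_) (sum-replicate-zero n) ⟩
    f u + 0#                         ≡⟨ +-identityʳ (f u) ⟩
    f u                              ∎

  ∑-offDiagonal-swap : ∀ {n} (H : Fin (suc n) → Fin (suc n) → Carrier) →
    ∑[ j < suc n ] ∑[ c < n ] H j (punchIn j c) ≡ ∑[ j < suc n ] ∑[ c < n ] H (punchIn j c) j
  ∑-offDiagonal-swap {n} H = +-cancelʳ diagonal _ _ (begin
    ∑[ j < suc n ] ∑[ c < n ] H j (punchIn j c) + diagonal
      ≡⟨ sym (∑-distrib-+ (λ j → ∑[ c < n ] H j (punchIn j c)) (λ j → H j j)) ⟩
    ∑[ j < suc n ] (∑[ c < n ] H j (punchIn j c) + H j j)
      ≡⟨ sum-cong-≗ (λ j → trans (+-comm _ (H j j)) (sym (sum-remove {i = j} (H j)))) ⟩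
    ∑[ j < suc n ] ∑[ k < suc n ] H j k
      ≡⟨ ∑-comm H ⟩
    ∑[ k < suc n ] ∑[ j < suc n ] H j k
      ≡⟨ sum-cong-≗ (λ k → trans (sum-remove {i = k} (λ j → H j k)) (+-comm (H k k) _)) ⟩
    ∑[ k < suc n ] (∑[ c < n ] H (punchIn k c) k + H k k)
      ≡⟨ ∑-distrib-+ (λ k → ∑[ c < n ] H (punchIn k c) k) (λ k → H k k) ⟩
    ∑[ j < suc n ] ∑[ c < n ] H (punchIn j c) j + diagonal
      ∎)
    where
    diagonal = ∑[ j < suc n ] H j j

  submatrix : ∀ {m n} → Matrix ℝ n → (Fin m → Fin n) → (Fin m → Fin n) → Matrix ℝ m
  submatrix A rows cols r c = A (rows r) (cols c)

  minor : ∀ {n} → Matrix ℝ (suc n) → Fin (suc n) → Fin (suc n) → Matrix ℝ n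
  minor A a b = submatrix A (punchIn a) (punchIn b)

  transpose : ∀ {n} → Matrix ℝ n → Matrix ℝ n
  transpose A r c = A c r

  per-expand-first : ∀ {n} (A : Matrix ℝ (suc n)) → per ℝ A ≡ ∑[ b < suc n ] (A zero b * per ℝ (minor A zero b))
  per-expand-first {n} A = Σ≡sum (suc n) (λ b → A zero b * per ℝ (minor A zero b))

  per-cong : ∀ {n} {A B : Matrix ℝ n} → (∀ r c → A r c ≡ B r c) → per ℝ A ≡ per ℝ B
  per-cong {zero}  _   = refl
  per-cong {suc n} {A} {B} A≗B = begin
    per ℝ A                                               ≡⟨ per-expand-first A ⟩
    ∑[ b < suc n ] (A zero b * per ℝ (minor A zero b))    ≡⟨ sum-cong-≗ (λ b → cong₂ _*_ (A≗B zero b) (per-cong (λ r c → A≗B (suc r) (punchIn b c)))) ⟩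
    ∑[ b < suc n ] (B zero b * per ℝ (minor B zero b))    ≡⟨ sym (per-expand-first B) ⟩
    per ℝ B                                               ∎

  punchIn-comm : ∀ {n} (b : Fin (suc (suc n))) (c : Fin (suc n)) (b≢ : ¬ punchIn b c ≡ b) (x : Fin n) →
                 punchIn (punchIn b c) (punchIn (punchOut b≢) x) ≡ punchIn b (punchIn c x)
  punchIn-comm zero    c       b≢ x       = refl
  punchIn-comm (suc b) zero    b≢ x       = refl
  punchIn-comm (suc b) (suc c) b≢ zero    = refl
  punchIn-comm (suc b) (suc c) b≢ (suc x) = cong suc (punchIn-comm b c (b≢ ∘ cong suc) x)

  -- The increasing enumeration of the complement of {j, k}; junk when j ≡ k.
  skip₂ : ∀ {n} → Fin (suc (suc n)) → Fin (suc (suc n)) → Fin n → Fin (suc (suc n))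
  skip₂ j k x with j ≟ k
  ... | yes _  = j
  ... | no j≢k = punchIn j (punchIn (punchOut j≢k) x)

  skip₂-punchInʳ : ∀ {n} (j : Fin (suc (suc n))) c x → skip₂ j (punchIn j c) x ≡ punchIn j (punchIn c x)
  skip₂-punchInʳ j c x with j ≟ punchIn j c
  ... | yes j≡ = ⊥-elim (punchInᵢ≢i j c (sym j≡))
  ... | no j≢  = cong (λ t → punchIn j (punchIn t x)) (trans (punchOut-cong j refl) (punchOut-punchIn j))

  skip₂-punchInˡ : ∀ {n} (b : Fin (suc (suc n))) c x → skip₂ (punchIn b c) b x ≡ punchIn b (punchIn c x)
  skip₂-punchInˡ b c x with punchIn b c ≟ b
  ... | yes b≡ = ⊥-elim (punchInᵢ≢i b c b≡)
  ... | no b≢  = punchIn-comm b c b≢ x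

  -- Expanding along row 0 and then along row a+1 sums over ordered pairs of columns;
  -- swapping the pairs gives the expansion along row a+1 first.
  per-expand-row : ∀ {n} (A : Matrix ℝ (suc n)) (a : Fin (suc n)) → per ℝ A ≡ ∑[ b < suc n ] (A a b * per ℝ (minor A a b))
  per-expand-row A zero = per-expand-first A
  per-expand-row {suc n} A (suc a) = begin
    per ℝ A
      ≡⟨ per-expand-first A ⟩
    ∑[ j < suc (suc n) ] (A zero j * per ℝ (minor A zero j))
      ≡⟨ sum-cong-≗ (λ j → cong (A zero j *_) (per-expand-row (minor A zero j) a)) ⟩
    ∑[ j < suc (suc n) ] (A zero j * ∑[ c < suc n ] (A (suc a) (punchIn j c) * Q (punchIn j ∘ punchIn c)))
      ≡⟨ sum-cong-≗ (λ j → trans (*-distribˡ-sum (A zero j) (λ c → A (suc a) (punchIn j c) * Q (punchIn j ∘ punchIn c))) (sum-cong-≗ (λ c →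
           cong (λ t → A zero j * (A (suc a) (punchIn j c) * t)) (Q-cong (sym ∘ skip₂-punchInʳ j c))))) ⟩
    ∑[ j < suc (suc n) ] ∑[ c < suc n ] H j (punchIn j c)
      ≡⟨ ∑-offDiagonal-swap H ⟩
    ∑[ b < suc (suc n) ] ∑[ c < suc n ] H (punchIn b c) b
      ≡⟨ sum-cong-≗ (λ b → trans (sum-cong-≗ (λ c →
           trans (cong (λ t → A zero (punchIn b c) * (A (suc a) b * t)) (Q-cong (skip₂-punchInˡ b c)))
                 (solve 3 (λ x y z → x :* (y :* z) := y :* (x :* z)) refl _ _ _)))
           (sym (*-distribˡ-sum (A (suc a) b) (λ c → A zero (punchIn b c) * Q (punchIn b ∘ punchIn c))))) ⟩
    ∑[ b < suc (suc n) ] (A (suc a) b * ∑[ c < suc n ] (A zero (punchIn b c) * Q (punchIn b ∘ punchIn c)))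
      ≡⟨ sum-cong-≗ (λ b → cong (A (suc a) b *_) (sym (per-expand-first (minor A (suc a) b)))) ⟩
    ∑[ b < suc (suc n) ] (A (suc a) b * per ℝ (minor A (suc a) b))
      ∎
    where
    Q : (Fin n → Fin (suc (suc n))) → Carrier
    Q cols = per ℝ (submatrix A (suc ∘ punchIn a) cols)
    Q-cong : ∀ {f g} → (∀ x → f x ≡ g x) → Q f ≡ Q g
    Q-cong f≗g = per-cong (λ r x → cong (A (suc (punchIn a r))) (f≗g x))
    H : Fin (suc (suc n)) → Fin (suc (suc n)) → Carrier
    H j k = A zero j * (A (suc a) k * Q (skip₂ j k))

  ∑-row-expansions : ∀ {n} (A : Matrix ℝ (suc n)) →
    ∑[ a < suc n ] ∑[ b < suc n ] (A a b * per ℝ (minor A a b)) ≡ suc n · per ℝ A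
  ∑-row-expansions {n} A = trans (sum-cong-≗ (sym ∘ per-expand-row A)) (sum-replicate (suc n) {per ℝ A})

  per-transpose : ∀ {n} (A : Matrix ℝ n) → per ℝ (transpose A) ≡ per ℝ A
  per-transpose {zero}  A = refl
  per-transpose {suc n} A = ·-cancel n (begin
    suc n · per ℝ (transpose A)                                        ≡⟨ sym (∑-row-expansions (transpose A)) ⟩
    ∑[ a < suc n ] ∑[ b < suc n ] (A b a * per ℝ (transpose (minor A b a)))
      ≡⟨ sum-cong-≗ (λ a → sum-cong-≗ (λ b → cong (A b a *_) (per-transpose (minor A b a)))) ⟩
    ∑[ a < suc n ] ∑[ b < suc n ] (A b a * per ℝ (minor A b a))      ≡⟨ ∑-comm (λ a b → A b a * per ℝ (minor A b a)) ⟩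
    ∑[ b < suc n ] ∑[ a < suc n ] (A b a * per ℝ (minor A b a))      ≡⟨ ∑-row-expansions A ⟩
    suc n · per ℝ A                                                    ∎)

  per-expand-column : ∀ {n} (A : Matrix ℝ (suc n)) (b : Fin (suc n)) → per ℝ A ≡ ∑[ a < suc n ] (A a b * per ℝ (minor A a b))
  per-expand-column A b = begin
    per ℝ A                                                   ≡⟨ sym (per-transpose A) ⟩
    per ℝ (transpose A)                                       ≡⟨ per-expand-row (transpose A) b ⟩
    ∑[ a < _ ] (A a b * per ℝ (transpose (minor A a b)))      ≡⟨ sum-cong-≗ (λ a → cong (A a b *_) (per-transpose (minor A a b))) ⟩
    ∑[ a < _ ] (A a b * per ℝ (minor A a b))                  ∎

  E-diag : ∀ {n} (i : Fin n) → E ℝ i i i ≡ 1#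
  E-diag i with i ≟ i
  ... | yes _   = refl
  ... | no i≢i = ⊥-elim (i≢i refl)

  E-offRow : ∀ {n} (i r c : Fin n) → ¬ r ≡ i → E ℝ i r c ≡ 0#
  E-offRow i r c r≢i with r ≟ i
  ... | yes r≡i = ⊥-elim (r≢i r≡i)
  ... | no _    = refl

  E-offColumn : ∀ {n} (i r c : Fin n) → ¬ c ≡ i → E ℝ i r c ≡ 0#
  E-offColumn i r c c≢i with r ≟ i | c ≟ i
  ... | yes _ | yes c≡i = ⊥-elim (c≢i c≡i)
  ... | yes _ | no _    = refl
  ... | no _  | _       = refl

  E-absorbs : ∀ {n} (i : Fin n) (A : Matrix ℝ n) r c → A r c * E ℝ i r c ≡ A i i * E ℝ i r c
  E-absorbs i A r c with r ≟ i | c ≟ i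
  ... | yes refl | yes refl = refl
  ... | yes _    | no _     = trans (zeroʳ _) (sym (zeroʳ _))
  ... | no _     | _        = trans (zeroʳ _) (sym (zeroʳ _))

  per-shift : ∀ {n} (B : Matrix ℝ (suc n)) (i : Fin (suc n)) β →
    per ℝ (_+ₘ_ ℝ B (_·ₘ_ ℝ β (E ℝ i))) ≡ per ℝ B + β * per ℝ (delete ℝ i B)
  per-shift {n} B i β = begin
    per ℝ B′
      ≡⟨ per-expand-row B′ i ⟩
    ∑[ b < suc n ] ((B i b + β * E ℝ i i b) * per ℝ (minor B′ i b))
      ≡⟨ sum-cong-≗ (λ b → trans (cong ((B i b + β * E ℝ i i b) *_) (per-cong (minor-unshifted b))) (distribʳ _ _ _)) ⟩
    ∑[ b < suc n ] (B i b * per ℝ (minor B i b) + β * E ℝ i i b * per ℝ (minor B i b))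
      ≡⟨ ∑-distrib-+ (λ b → B i b * per ℝ (minor B i b)) (λ b → β * E ℝ i i b * per ℝ (minor B i b)) ⟩
    ∑[ b < suc n ] (B i b * per ℝ (minor B i b)) + ∑[ b < suc n ] (β * E ℝ i i b * per ℝ (minor B i b))
      ≡⟨ cong₂ _+_ (sym (per-expand-row B i)) (sum-sift _ i offDiagonal-vanishes) ⟩
    per ℝ B + β * E ℝ i i i * per ℝ (delete ℝ i B)
      ≡⟨ cong (λ t → per ℝ B + β * t * per ℝ (delete ℝ i B)) (E-diag i) ⟩
    per ℝ B + β * 1# * per ℝ (delete ℝ i B)
      ≡⟨ cong (λ t → per ℝ B + t * per ℝ (delete ℝ i B)) (*-identityʳ β) ⟩
    per ℝ B + β * per ℝ (delete ℝ i B)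
      ∎
    where
    B′ = _+ₘ_ ℝ B (_·ₘ_ ℝ β (E ℝ i))
    minor-unshifted : ∀ b r c → minor B′ i b r c ≡ minor B i b r c
    minor-unshifted b r c = begin
      B (punchIn i r) (punchIn b c) + β * E ℝ i (punchIn i r) (punchIn b c)
        ≡⟨ cong (λ t → B (punchIn i r) (punchIn b c) + β * t) (E-offRow i _ _ (punchInᵢ≢i i r)) ⟩
      B (punchIn i r) (punchIn b c) + β * 0#
        ≡⟨ solve 2 (λ x β → x :+ β :* con 0 := x) refl _ β ⟩
      B (punchIn i r) (punchIn b c)
        ∎
    offDiagonal-vanishes : ∀ b → ¬ b ≡ i → β * E ℝ i i b * per ℝ (minor B i b) ≡ 0#
    offDiagonal-vanishes b b≢i = trans (cong (λ t → β * t * per ℝ (minor B i b)) (E-offColumn i i b b≢i))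
                                       (solve 2 (λ β P → β :* con 0 :* P := con 0) refl β _)

  hadamard-shift : ∀ {n} (A : Matrix ℝ n) (i : Fin n) α r c →
    let A′ = _+ₘ_ ℝ A (_·ₘ_ ℝ α (E ℝ i)) in
    _∘ₕ_ ℝ A′ A′ r c ≡ _+ₘ_ ℝ (_∘ₕ_ ℝ A A) (_·ₘ_ ℝ ((α + α) * A i i + α * α) (E ℝ i)) r c
  hadamard-shift A i α r c = begin
    (x + α * e) * (x + α * e)
      ≡⟨ solve 3 (λ x α e → (x :+ α :* e) :* (x :+ α :* e) := x :* x :+ (α :+ α) :* (x :* e) :+ α :* α :* (e :* e)) refl x α e ⟩
    x * x + (α + α) * (x * e) + α * α * (e * e)
      ≡⟨ cong₂ (λ s t → x * x + (α + α) * s + α * α * t) (E-absorbs i A r c) (trans (E-absorbs i (E ℝ i) r c) (cong (_* e) (E-diag i))) ⟩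
    x * x + (α + α) * (A i i * e) + α * α * (1# * e)
      ≡⟨ solve 4 (λ x α a e → x :* x :+ (α :+ α) :* (a :* e) :+ α :* α :* (con 1 :* e) := x :* x :+ ((α :+ α) :* a :+ α :* α) :* e) refl x α (A i i) e ⟩
    x * x + ((α + α) * A i i + α * α) * e
      ∎
    where
    x = A r c
    e = E ℝ i r c

  -- Kernels and the Schur product theorem

  ∑ₗ : List X → (X → Carrier) → Carrier
  ∑ₗ []      f = 0#
  ∑ₗ (x ∷ L) f = f x + ∑ₗ L f

  ∑ₗ-cong : ∀ (L : List X) {f g : X → Carrier} → (∀ x → f x ≡ g x) → ∑ₗ L f ≡ ∑ₗ L g
  ∑ₗ-cong []      f≗g = refl
  ∑ₗ-cong (x ∷ L) f≗g = cong₂ _+_ (f≗g x) (∑ₗ-cong L f≗g)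

  ∑ₗ-zero : ∀ (L : List X) → ∑ₗ L (λ _ → 0#) ≡ 0#
  ∑ₗ-zero []      = refl
  ∑ₗ-zero (x ∷ L) = trans (+-identityˡ _) (∑ₗ-zero L)

  ∑ₗ-distrib-+ : ∀ (L : List X) (f g : X → Carrier) → ∑ₗ L (λ x → f x + g x) ≡ ∑ₗ L f + ∑ₗ L g
  ∑ₗ-distrib-+ []      f g = sym (+-identityˡ 0#)
  ∑ₗ-distrib-+ (x ∷ L) f g = trans (cong (f x + g x +_) (∑ₗ-distrib-+ L f g))
    (solve 4 (λ a b c d → a :+ b :+ (c :+ d) := a :+ c :+ (b :+ d)) refl (f x) (g x) (∑ₗ L f) (∑ₗ L g))

  *-distribˡ-∑ₗ : ∀ (L : List X) c (f : X → Carrier) → c * ∑ₗ L f ≡ ∑ₗ L (λ x → c * f x)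
  *-distribˡ-∑ₗ []      c f = zeroʳ c
  *-distribˡ-∑ₗ (x ∷ L) c f = trans (distribˡ c _ _) (cong (c * f x +_) (*-distribˡ-∑ₗ L c f))

  ∑ₗ-++ : ∀ (L M : List X) (f : X → Carrier) → ∑ₗ (L ++ M) f ≡ ∑ₗ L f + ∑ₗ M f
  ∑ₗ-++ []      M f = sym (+-identityˡ _)
  ∑ₗ-++ (x ∷ L) M f = trans (cong (f x +_) (∑ₗ-++ L M f)) (sym (+-assoc _ _ _))

  ∑ₗ-map : ∀ (g : X → Y) (L : List X) (f : Y → Carrier) → ∑ₗ (map g L) f ≡ ∑ₗ L (f ∘ g)
  ∑ₗ-map g []      f = refl
  ∑ₗ-map g (x ∷ L) f = cong (f (g x) +_) (∑ₗ-map g L f)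

  ∑ₗ-cartesianProduct : ∀ (L : List X) (M : List Y) (f : X × Y → Carrier) →
                        ∑ₗ (cartesianProduct L M) f ≡ ∑ₗ L (λ x → ∑ₗ M (λ y → f (x , y)))
  ∑ₗ-cartesianProduct []      M f = refl
  ∑ₗ-cartesianProduct (x ∷ L) M f = begin
    ∑ₗ (map (x ,_) M ++ cartesianProduct L M) f             ≡⟨ ∑ₗ-++ (map (x ,_) M) _ f ⟩
    ∑ₗ (map (x ,_) M) f + ∑ₗ (cartesianProduct L M) f       ≡⟨ cong₂ _+_ (∑ₗ-map (x ,_) M f) (∑ₗ-cartesianProduct L M f) ⟩
    ∑ₗ M (λ y → f (x , y)) + ∑ₗ L (λ x → ∑ₗ M (λ y → f (x , y))) ∎

  ∑ₗ-comm : ∀ (L : List X) (M : List Y) (f : X → Y → Carrier) →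
            ∑ₗ L (λ x → ∑ₗ M (f x)) ≡ ∑ₗ M (λ y → ∑ₗ L (λ x → f x y))
  ∑ₗ-comm []      M f = sym (∑ₗ-zero M)
  ∑ₗ-comm (x ∷ L) M f = trans (cong (∑ₗ M (f x) +_) (∑ₗ-comm L M f)) (sym (∑ₗ-distrib-+ M (f x) _))

  ∑ₗ-tabulate : ∀ {n} (g : Fin n → X) (f : X → Carrier) → ∑ₗ (tabulate g) f ≡ sum (f ∘ g)
  ∑ₗ-tabulate {n = zero}  g f = refl
  ∑ₗ-tabulate {n = suc n} g f = cong (f (g zero) +_) (∑ₗ-tabulate (g ∘ suc) f)

  ∑∑ₗ : List X → (X → X → Carrier) → Carrier
  ∑∑ₗ L f = ∑ₗ L (λ x → ∑ₗ L (f x))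

  ∑∑ₗ-cong : ∀ (L : List X) {f g : X → X → Carrier} → (∀ x y → f x y ≡ g x y) → ∑∑ₗ L f ≡ ∑∑ₗ L g
  ∑∑ₗ-cong L f≗g = ∑ₗ-cong L (λ x → ∑ₗ-cong L (f≗g x))

  ∑∑ₗ-distrib-+ : ∀ (L : List X) (f g : X → X → Carrier) → ∑∑ₗ L (λ x y → f x y + g x y) ≡ ∑∑ₗ L f + ∑∑ₗ L g
  ∑∑ₗ-distrib-+ L f g = trans (∑ₗ-cong L (λ x → ∑ₗ-distrib-+ L (f x) (g x))) (∑ₗ-distrib-+ L _ _)

  *-distribˡ-∑∑ₗ : ∀ (L : List X) c (f : X → X → Carrier) → c * ∑∑ₗ L f ≡ ∑∑ₗ L (λ x y → c * f x y)
  *-distribˡ-∑∑ₗ L c f = trans (*-distribˡ-∑ₗ L c _) (∑ₗ-cong L (λ x → *-distribˡ-∑ₗ L c (f x)))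

  ∑ₗ-*-∑ₗ : ∀ (L : List X) (f g : X → Carrier) → ∑ₗ L f * ∑ₗ L g ≡ ∑∑ₗ L (λ x y → f x * g y)
  ∑ₗ-*-∑ₗ L f g = begin
    ∑ₗ L f * ∑ₗ L g                       ≡⟨ *-comm _ _ ⟩
    ∑ₗ L g * ∑ₗ L f                       ≡⟨ *-distribˡ-∑ₗ L (∑ₗ L g) f ⟩
    ∑ₗ L (λ x → ∑ₗ L g * f x)             ≡⟨ ∑ₗ-cong L (λ x → trans (*-comm _ (f x)) (*-distribˡ-∑ₗ L (f x) g)) ⟩
    ∑∑ₗ L (λ x y → f x * g y)             ∎

  ∑∑ₗ-allFin : ∀ {n} (f : Fin n → Fin n → Carrier) → ∑∑ₗ (allFin n) f ≡ ∑[ a < n ] ∑[ b < n ] f a b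
  ∑∑ₗ-allFin {n} f = trans (∑ₗ-tabulate id (λ a → ∑ₗ (allFin n) (f a))) (sum-cong-≗ (λ a → ∑ₗ-tabulate id (f a)))

  -- Kernels are indexed by lists, so that the index set can grow to pairs (x , a) in an induction.
  PosSemidefKernel : List X → (X → X → Carrier) → Set
  PosSemidefKernel {X} L K = ∀ (ν : X → Carrier) → 0# ≤ ∑∑ₗ L (λ x y → ν x * ν y * K x y)

  δ : ∀ {n} → Fin n → Fin n → Carrier
  δ u x with x ≟ u
  ... | yes _ = 1#
  ... | no _  = 0#

  δ-self : ∀ {n} (u : Fin n) → δ u u ≡ 1#
  δ-self u with u ≟ u
  ... | yes _   = refl
  ... | no u≢u = ⊥-elim (u≢u refl)

  δ-off : ∀ {n} (u x : Fin n) → ¬ x ≡ u → δ u x ≡ 0#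
  δ-off u x x≢u with x ≟ u
  ... | yes x≡u = ⊥-elim (x≢u x≡u)
  ... | no _    = refl

  dot : ∀ {n} → (Fin n → Carrier) → (Fin n → Carrier) → Carrier
  dot {n} u x = ∑[ b < n ] (u b * x b)

  form : ∀ {n} → Matrix ℝ n → (Fin n → Carrier) → (Fin n → Carrier) → Carrier
  form {n} A x y = ∑[ a < n ] ∑[ b < n ] (x a * A a b * y b)

  Σ²≡form : ∀ {n} (A : Matrix ℝ n) x → Σ[_] ℝ n (λ a → Σ[_] ℝ n (λ b → x a * A a b * x b)) ≡ form A x x
  Σ²≡form {n} A x = trans (Σ≡sum n _) (sum-cong-≗ (λ a → Σ≡sum n (λ b → x a * A a b * x b)))

  form-nonneg : ∀ {n} {A : Matrix ℝ n} → PosSemidef ℝ A → ∀ x → 0# ≤ form A x x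
  form-nonneg {A = A} (_ , nonneg) x = subst (0# ≤_) (Σ²≡form A x) (nonneg x)

  psd-from-form : ∀ {n} {A : Matrix ℝ n} → Symmetric ℝ A → (∀ x → 0# ≤ form A x x) → PosSemidef ℝ A
  psd-from-form {A = A} symmetric nonneg = symmetric , λ x → subst (0# ≤_) (sym (Σ²≡form A x)) (nonneg x)

  form-scale : ∀ {n} (A : Matrix ℝ n) q x y → form A (λ b → q * x b) (λ b → q * y b) ≡ q * q * form A x y
  form-scale {n} A q x y = sym (trans (*-distribˡ-sum (q * q) (λ a → ∑[ b < n ] (x a * A a b * y b))) (sum-cong-≗ (λ a →
    trans (*-distribˡ-sum (q * q) (λ b → x a * A a b * y b)) (sum-cong-≗ (λ b →
      solve 4 (λ q x m y → q :* q :* (x :* m :* y) := q :* x :* m :* (q :* y)) refl q (x a) (A a b) (y b))))))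

  form-δ : ∀ {n} (A : Matrix ℝ n) α β u v → form A (λ z → α * δ u z) (λ z → β * δ v z) ≡ α * β * A u v
  form-δ A α β u v = begin
    form A (λ z → α * δ u z) (λ z → β * δ v z)
      ≡⟨ sum-cong-≗ (λ a → sum-sift _ v (λ b b≢v →
           trans (cong (λ t → α * δ u a * A a b * (β * t)) (δ-off v b b≢v)) (solve 2 (λ x β → x :* (β :* con 0) := con 0) refl _ β))) ⟩
    ∑[ a < _ ] (α * δ u a * A a v * (β * δ v v))
      ≡⟨ sum-sift _ u (λ a a≢u →
           trans (cong (λ t → α * t * A a v * (β * δ v v)) (δ-off u a a≢u)) (solve 3 (λ α m y → α :* con 0 :* m :* y := con 0) refl α (A a v) _)) ⟩
    α * δ u u * A u v * (β * δ v v)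
      ≡⟨ cong₂ (λ s t → α * s * A u v * (β * t)) (δ-self u) (δ-self v) ⟩
    α * 1# * A u v * (β * 1#)
      ≡⟨ solve 3 (λ α m β → α :* con 1 :* m :* (β :* con 1) := α :* β :* m) refl α (A u v) β ⟩
    α * β * A u v
      ∎

  diag-nonneg : ∀ {n} {A : Matrix ℝ n} → PosSemidef ℝ A → ∀ u → 0# ≤ A u u
  diag-nonneg {A = A} psd u = subst (0# ≤_) (trans (form-δ A 1# 1# u u) (solve 1 (λ a → con 1 :* con 1 :* a := a) refl (A u u)))
                                          (form-nonneg psd (λ z → 1# * δ u z))

  sum-*-sum : ∀ {n} (u v : Fin n → Carrier) → sum u * sum v ≡ ∑[ a < n ] ∑[ b < n ] (u a * v b)
  sum-*-sum u v = trans (*-distribʳ-sum (sum v) u) (sum-cong-≗ (λ a → *-distribˡ-sum (u a) v))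

  module SchurComplement {N} (A : Matrix ℝ (suc N)) (symmetric : Symmetric ℝ A) where

    pivot : Carrier
    pivot = A zero zero

    column : Fin N → Carrier
    column b = A zero (suc b)

    lower : Matrix ℝ N
    lower = minor A zero zero

    schur : Carrier → Matrix ℝ N
    schur q a b = q * lower a b - column a * column b

    form-split : ∀ x y → form A x y ≡ x zero * pivot * y zero + x zero * dot column (y ∘ suc)
                                       + dot column (x ∘ suc) * y zero + form lower (x ∘ suc) (y ∘ suc)
    form-split x y = begin
      (x zero * pivot * y zero + ∑[ b < N ] (x zero * column b * y (suc b)))
        + ∑[ a < N ] (x (suc a) * A (suc a) zero * y zero + ∑[ b < N ] (x (suc a) * lower a b * y (suc b)))
        ≡⟨ cong₂ _+_ (cong (x zero * pivot * y zero +_) first-row)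
                     (trans (∑-distrib-+ (λ a → x (suc a) * A (suc a) zero * y zero) (λ a → ∑[ b < N ] (x (suc a) * lower a b * y (suc b))))
                            (cong (_+ form lower (x ∘ suc) (y ∘ suc)) first-column)) ⟩
      (x zero * pivot * y zero + x zero * dot column (y ∘ suc)) + (dot column (x ∘ suc) * y zero + form lower (x ∘ suc) (y ∘ suc))
        ≡⟨ sym (+-assoc _ _ _) ⟩
      x zero * pivot * y zero + x zero * dot column (y ∘ suc) + dot column (x ∘ suc) * y zero + form lower (x ∘ suc) (y ∘ suc)
        ∎
      where
      first-row : ∑[ b < N ] (x zero * column b * y (suc b)) ≡ x zero * dot column (y ∘ suc)
      first-row = trans (sum-cong-≗ (λ b → *-assoc (x zero) (column b) (y (suc b)))) (sym (*-distribˡ-sum (x zero) (λ b → column b * y (suc b))))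
      first-column : ∑[ a < N ] (x (suc a) * A (suc a) zero * y zero) ≡ dot column (x ∘ suc) * y zero
      first-column = trans (sum-cong-≗ (λ a → cong (_* y zero) (trans (cong (x (suc a) *_) (symmetric (suc a) zero)) (*-comm _ _))))
                           (sym (*-distribʳ-sum (y zero) (λ a → column a * x (suc a))))

    form-schur : ∀ q x y → form (schur q) x y + dot column x * dot column y ≡ q * form lower x y
    form-schur q x y = begin
      form (schur q) x y + dot column x * dot column y
        ≡⟨ cong (form (schur q) x y +_) (sum-*-sum (λ a → column a * x a) (λ b → column b * y b)) ⟩
      form (schur q) x y + ∑[ a < N ] ∑[ b < N ] (column a * x a * (column b * y b))
        ≡⟨ sym (trans (sum-cong-≗ (λ a → ∑-distrib-+ (λ b → x a * schur q a b * y b) (λ b → column a * x a * (column b * y b))))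
                      (∑-distrib-+ (λ a → ∑[ b < N ] (x a * schur q a b * y b)) (λ a → ∑[ b < N ] (column a * x a * (column b * y b))))) ⟩
      ∑[ a < N ] ∑[ b < N ] (x a * schur q a b * y b + column a * x a * (column b * y b))
        ≡⟨ sum-cong-≗ (λ a → sum-cong-≗ (λ b → entry (x a) (y b) (column a) (column b) (lower a b))) ⟩
      ∑[ a < N ] ∑[ b < N ] (q * (x a * lower a b * y b))
        ≡⟨ sym (trans (*-distribˡ-sum q (λ a → ∑[ b < N ] (x a * lower a b * y b))) (sum-cong-≗ (λ a → *-distribˡ-sum q (λ b → x a * lower a b * y b)))) ⟩
      q * form lower x y
        ∎
      where
      entry : ∀ x y c d m → x * (q * m - c * d) * y + c * x * (d * y) ≡ q * (x * m * y)
      entry x y c d m = begin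
        x * (q * m - c * d) * y + c * x * (d * y)
          ≡⟨ solve 5 (λ x y c d s → x :* s :* y :+ c :* x :* (d :* y) := x :* (s :+ c :* d) :* y) refl x y c d (q * m - c * d) ⟩
        x * (q * m - c * d + c * d) * y      ≡⟨ cong (λ t → x * t * y) (x-y+y≡x (q * m) (c * d)) ⟩
        x * (q * m) * y                      ≡⟨ solve 4 (λ x y q m → x :* (q :* m) :* y := q :* (x :* m :* y)) refl x y q m ⟩
        q * (x * m * y)                      ∎

    lead : Carrier → (Fin (suc N) → Carrier) → Carrier
    lead q x = q * x zero + dot column (x ∘ suc)

    schur-identity : ∀ ε x y →
      (pivot + ε) * (form A x y + ε * (x zero * y zero))
        ≡ lead (pivot + ε) x * lead (pivot + ε) y + form (schur (pivot + ε)) (x ∘ suc) (y ∘ suc)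
    schur-identity ε x y = +-cancelʳ (cx * cy) _ _ (begin
      q * (form A x y + ε * (x₀ * y₀)) + cx * cy
        ≡⟨ cong (λ t → q * (t + ε * (x₀ * y₀)) + cx * cy) (form-split x y) ⟩
      q * (x₀ * pivot * y₀ + x₀ * cy + cx * y₀ + F + ε * (x₀ * y₀)) + cx * cy
        ≡⟨ solve 7 (λ p ε x₀ y₀ cx cy F →
             (p :+ ε) :* (x₀ :* p :* y₀ :+ x₀ :* cy :+ cx :* y₀ :+ F :+ ε :* (x₀ :* y₀)) :+ cx :* cy
               := ((p :+ ε) :* x₀ :+ cx) :* ((p :+ ε) :* y₀ :+ cy) :+ (p :+ ε) :* F) refl pivot ε x₀ y₀ cx cy F ⟩
      lead q x * lead q y + q * F
        ≡⟨ cong (lead q x * lead q y +_) (sym (form-schur q (x ∘ suc) (y ∘ suc))) ⟩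
      lead q x * lead q y + (form (schur q) (x ∘ suc) (y ∘ suc) + cx * cy)
        ≡⟨ sym (+-assoc _ _ _) ⟩
      lead q x * lead q y + form (schur q) (x ∘ suc) (y ∘ suc) + cx * cy
        ∎)
      where
      q  = pivot + ε
      x₀ = x zero
      y₀ = y zero
      cx = dot column (x ∘ suc)
      cy = dot column (y ∘ suc)
      F  = form lower (x ∘ suc) (y ∘ suc)

    ∑∑ₗ-schur-identity : ∀ ε (L : List X) (K : X → X → Carrier) (w : X → Fin (suc N) → Carrier) →
      (pivot + ε) * (∑∑ₗ L (λ x y → K x y * form A (w x) (w y)) + ε * ∑∑ₗ L (λ x y → w x zero * w y zero * K x y))
        ≡ ∑∑ₗ L (λ x y → lead (pivot + ε) (w x) * lead (pivot + ε) (w y) * K x y)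
          + ∑∑ₗ L (λ x y → K x y * form (schur (pivot + ε)) (w x ∘ suc) (w y ∘ suc))
    ∑∑ₗ-schur-identity ε L K w = begin
      q * (∑∑ₗ L (λ x y → K x y * form A (w x) (w y)) + ε * ∑∑ₗ L (λ x y → w x zero * w y zero * K x y))
        ≡⟨ cong (λ t → q * (∑∑ₗ L (λ x y → K x y * form A (w x) (w y)) + t)) (*-distribˡ-∑∑ₗ L ε _) ⟩
      q * (∑∑ₗ L (λ x y → K x y * form A (w x) (w y)) + ∑∑ₗ L (λ x y → ε * (w x zero * w y zero * K x y)))
        ≡⟨ cong (q *_) (sym (∑∑ₗ-distrib-+ L _ _)) ⟩
      q * ∑∑ₗ L (λ x y → K x y * form A (w x) (w y) + ε * (w x zero * w y zero * K x y))
        ≡⟨ *-distribˡ-∑∑ₗ L q _ ⟩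
      ∑∑ₗ L (λ x y → q * (K x y * form A (w x) (w y) + ε * (w x zero * w y zero * K x y)))
        ≡⟨ ∑∑ₗ-cong L entry ⟩
      ∑∑ₗ L (λ x y → ν x * ν y * K x y + K x y * form (schur q) (w x ∘ suc) (w y ∘ suc))
        ≡⟨ ∑∑ₗ-distrib-+ L _ _ ⟩
      ∑∑ₗ L (λ x y → ν x * ν y * K x y) + ∑∑ₗ L (λ x y → K x y * form (schur q) (w x ∘ suc) (w y ∘ suc))
        ∎
      where
      q = pivot + ε
      ν = λ x → lead q (w x)
      entry : ∀ x y → q * (K x y * form A (w x) (w y) + ε * (w x zero * w y zero * K x y))
                      ≡ ν x * ν y * K x y + K x y * form (schur q) (w x ∘ suc) (w y ∘ suc)
      entry x y = begin
        q * (k * form A (w x) (w y) + ε * (w x zero * w y zero * k))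
          ≡⟨ solve 6 (λ q k F ε a b → q :* (k :* F :+ ε :* (a :* b :* k)) := k :* (q :* (F :+ ε :* (a :* b)))) refl q k _ ε _ _ ⟩
        k * (q * (form A (w x) (w y) + ε * (w x zero * w y zero)))
          ≡⟨ cong (k *_) (schur-identity ε (w x) (w y)) ⟩
        k * (ν x * ν y + form (schur q) (w x ∘ suc) (w y ∘ suc))
          ≡⟨ solve 4 (λ k a b G → k :* (a :* b :+ G) := a :* b :* k :+ k :* G) refl k (ν x) (ν y) _ ⟩
        ν x * ν y * k + k * form (schur q) (w x ∘ suc) (w y ∘ suc)
          ∎
        where
        k = K x y

    module _ (psd : PosSemidef ℝ A) (ε : Carrier) (0≤ε : 0# ≤ ε) where

      0≤pivot+ε : 0# ≤ pivot + ε
      0≤pivot+ε = +-nonneg (diag-nonneg psd zero) 0≤ε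

      pivot+ε≢0 : ¬ ε ≡ 0# → ¬ pivot + ε ≡ 0#
      pivot+ε≢0 ε≢0 q≡0 = ε≢0 (antisym (subst (ε ≤_) q≡0 ε≤q) 0≤ε)
        where
        ε≤q : ε ≤ pivot + ε
        ε≤q = subst (_≤ pivot + ε) (+-identityˡ ε) (+-monoˡ-≤ ε (diag-nonneg psd zero))

      schur-psd : ¬ ε ≡ 0# → PosSemidef ℝ (schur (pivot + ε))
      schur-psd ε≢0 = psd-from-form schur-symmetric schur-nonneg
        where
        q = pivot + ε
        q≢0 = pivot+ε≢0 ε≢0
        schur-symmetric : Symmetric ℝ (schur q)
        schur-symmetric a b = cong₂ (λ s t → q * s - t) (symmetric (suc a) (suc b)) (*-comm (column a) (column b))
        -- Evaluate the Schur identity at the vector (-(column · x), q x), whose lead vanishes.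
        schur-nonneg : ∀ x → 0# ≤ form (schur q) x x
        schur-nonneg x = *-nonneg-cancelˡ 0≤pivot+ε q≢0
          (subst (0# ≤_) (sym q·form≡) (+-nonneg (form-nonneg psd v) (*-nonneg 0≤ε (square-nonneg (- d)))))
          where
          d = dot column x
          v : Fin (suc N) → Carrier
          v zero    = - d
          v (suc b) = q * x b
          lead-v≡0 : lead q v ≡ 0#
          lead-v≡0 = begin
            q * - d + dot column (v ∘ suc) ≡⟨ cong₂ _+_ (sym (-‿distribʳ-* q d)) column·qx≡qd ⟩
            - (q * d) + q * d              ≡⟨ -‿inverseˡ (q * d) ⟩
            0#                             ∎
            where
            column·qx≡qd : dot column (v ∘ suc) ≡ q * d
            column·qx≡qd = trans (sum-cong-≗ (λ b → solve 3 (λ c q x → c :* (q :* x) := q :* (c :* x)) refl (column b) q (x b)))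
                                 (sym (*-distribˡ-sum q (λ b → column b * x b)))
          q·form≡ : q * form (schur q) x x ≡ form A v v + ε * (- d * - d)
          q·form≡ = *-cancelˡ q≢0 (begin
            q * (q * form (schur q) x x)
              ≡⟨ solve 2 (λ q F → q :* (q :* F) := con 0 :* con 0 :+ q :* q :* F) refl q _ ⟩
            0# * 0# + q * q * form (schur q) x x
              ≡⟨ cong₂ (λ s t → s * s + t) (sym lead-v≡0) (sym (form-scale (schur q) q x x)) ⟩
            lead q v * lead q v + form (schur q) (v ∘ suc) (v ∘ suc)
              ≡⟨ sym (schur-identity ε v v) ⟩
            q * (form A v v + ε * (- d * - d))
              ∎)

  schur-product-nonneg : ∀ {N} (A : Matrix ℝ N) → PosSemidef ℝ A → (L : List X) (K : X → X → Carrier) → PosSemidefKernel L K →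
    (w : X → Fin N → Carrier) → 0# ≤ ∑∑ₗ L (λ x y → K x y * form A (w x) (w y))
  schur-product-nonneg {N = zero} A psd L K K-psd w =
    ≤-reflexive (sym (trans (∑∑ₗ-cong L (λ x y → zeroʳ (K x y))) (trans (∑ₗ-cong L (λ _ → ∑ₗ-zero L)) (∑ₗ-zero L))))
  schur-product-nonneg {N = suc N} A psd@(symmetric , _) L K K-psd w = nonneg-by-perturbation _ _ perturbed
    where
    open SchurComplement A symmetric
    perturbed : ∀ ε → 0# ≤ ε → ¬ ε ≡ 0# →
                0# ≤ ∑∑ₗ L (λ x y → K x y * form A (w x) (w y)) + ε * ∑∑ₗ L (λ x y → w x zero * w y zero * K x y)
    perturbed ε 0≤ε ε≢0 = *-nonneg-cancelˡ (0≤pivot+ε psd ε 0≤ε) (pivot+ε≢0 psd ε 0≤ε ε≢0)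
      (subst (0# ≤_) (sym (∑∑ₗ-schur-identity ε L K w))
        (+-nonneg (K-psd (lead (pivot + ε) ∘ w))
                  (schur-product-nonneg (schur (pivot + ε)) (schur-psd psd ε 0≤ε ε≢0) L K K-psd (λ x → w x ∘ suc))))

  -- Permanents of positive semidefinite matrices

  -- Induction on the size of the submatrices: expanding along every row turns the
  -- kernel for size m+1 into a Schur product of A with the kernel for size m.
  per-kernel-psd : ∀ {N} (A : Matrix ℝ N) → PosSemidef ℝ A → ∀ {m} (L : List X) (S : X → Fin m → Fin N) →
    PosSemidefKernel L (λ s t → per ℝ (submatrix A (S s) (S t)))
  per-kernel-psd A psd {zero} L S ν =
    subst (0# ≤_) (trans (∑ₗ-*-∑ₗ L ν ν) (∑∑ₗ-cong L (λ s t → sym (*-identityʳ _)))) (square-nonneg (∑ₗ L ν))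
  per-kernel-psd {X = X} {N = N} A psd {suc m} L S ν = *-nonneg-cancelˡ (·-nonneg (suc m) 0≤1) (suc·1≢0 m)
    (subst (0# ≤_) expansion (schur-product-nonneg A psd pairs K (per-kernel-psd A psd pairs rows) w))
    where
    Fs = allFin (suc m)
    pairs : List (X × Fin (suc m))
    pairs = cartesianProduct L Fs
    rows : X × Fin (suc m) → Fin m → Fin N
    rows (s , a) = S s ∘ punchIn a
    K : X × Fin (suc m) → X × Fin (suc m) → Carrier
    K x y = per ℝ (submatrix A (rows x) (rows y))
    w : X × Fin (suc m) → Fin N → Carrier
    w (s , a) z = ν s * δ (S s a) z
    M : X → X → Matrix ℝ (suc m)
    M s t = submatrix A (S s) (S t)
    term : X → X → Fin (suc m) → Fin (suc m) → Carrier
    term s t a b = ν s * ν t * (M s t a b * per ℝ (minor (M s t) a b))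
    row-expansions : ∀ s t → ∑∑ₗ Fs (term s t) ≡ suc m · 1# * (ν s * ν t * per ℝ (M s t))
    row-expansions s t = begin
      ∑∑ₗ Fs (term s t)
        ≡⟨ sym (*-distribˡ-∑∑ₗ Fs (ν s * ν t) _) ⟩
      ν s * ν t * ∑∑ₗ Fs (λ a b → M s t a b * per ℝ (minor (M s t) a b))
        ≡⟨ cong (ν s * ν t *_) (trans (∑∑ₗ-allFin (λ a b → M s t a b * per ℝ (minor (M s t) a b))) (∑-row-expansions (M s t))) ⟩
      ν s * ν t * (suc m · per ℝ (M s t))
        ≡⟨ cong (ν s * ν t *_) (·≡·1* (suc m) _) ⟩
      ν s * ν t * (suc m · 1# * per ℝ (M s t))
        ≡⟨ solve 3 (λ v k P → v :* (k :* P) := k :* (v :* P)) refl (ν s * ν t) (suc m · 1#) _ ⟩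
      suc m · 1# * (ν s * ν t * per ℝ (M s t))
        ∎
    expansion : ∑∑ₗ pairs (λ x y → K x y * form A (w x) (w y)) ≡ suc m · 1# * ∑∑ₗ L (λ s t → ν s * ν t * per ℝ (M s t))
    expansion = begin
      ∑∑ₗ pairs (λ x y → K x y * form A (w x) (w y))
        ≡⟨ trans (∑ₗ-cartesianProduct L Fs _) (∑ₗ-cong L (λ s → ∑ₗ-cong Fs (λ a → ∑ₗ-cartesianProduct L Fs _))) ⟩
      ∑ₗ L (λ s → ∑ₗ Fs (λ a → ∑ₗ L (λ t → ∑ₗ Fs (λ b → K (s , a) (t , b) * form A (w (s , a)) (w (t , b))))))
        ≡⟨ ∑ₗ-cong L (λ s → ∑ₗ-cong Fs (λ a → ∑ₗ-cong L (λ t → ∑ₗ-cong Fs (λ b →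
             trans (cong (K (s , a) (t , b) *_) (form-δ A (ν s) (ν t) (S s a) (S t b)))
                   (solve 4 (λ k x y m → k :* (x :* y :* m) := x :* y :* (m :* k)) refl _ (ν s) (ν t) _))))) ⟩
      ∑ₗ L (λ s → ∑ₗ Fs (λ a → ∑ₗ L (λ t → ∑ₗ Fs (term s t a))))
        ≡⟨ ∑ₗ-cong L (λ s → ∑ₗ-comm Fs L (λ a t → ∑ₗ Fs (term s t a))) ⟩
      ∑∑ₗ L (λ s t → ∑∑ₗ Fs (term s t))
        ≡⟨ ∑∑ₗ-cong L row-expansions ⟩
      ∑∑ₗ L (λ s t → suc m · 1# * (ν s * ν t * per ℝ (M s t)))
        ≡⟨ sym (*-distribˡ-∑∑ₗ L (suc m · 1#) _) ⟩
      suc m · 1# * ∑∑ₗ L (λ s t → ν s * ν t * per ℝ (M s t))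
        ∎

  per-principal-nonneg : ∀ {N m} {A : Matrix ℝ N} → PosSemidef ℝ A → (S : Fin m → Fin N) → 0# ≤ per ℝ (submatrix A S S)
  per-principal-nonneg {A = A} psd S = subst (0# ≤_) (solve 1 (λ P → con 1 :* con 1 :* P :+ con 0 :+ con 0 := P) refl _)
                                                     (per-kernel-psd A psd (tt ∷ []) (λ _ → S) (λ _ → 1#))

  per-minor-offDiagonal : ∀ {n} (A : Matrix ℝ (suc (suc n))) → Symmetric ℝ A → ∀ i c →
    per ℝ (minor A i (punchIn i c))
      ≡ ∑[ k < suc n ] (A i (punchIn i k) * per ℝ (submatrix A (punchIn i ∘ punchIn k) (punchIn i ∘ punchIn c)))
  per-minor-offDiagonal {n} A symmetric i c = begin
    per ℝ (minor A i j)
      ≡⟨ per-expand-column (minor A i j) i′ ⟩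
    ∑[ k < suc n ] (A (punchIn i k) (punchIn j i′) * per ℝ (minor (minor A i j) k i′))
      ≡⟨ sum-cong-≗ (λ k → cong₂ _*_ (trans (cong (A (punchIn i k)) (punchIn-punchOut j≢i)) (symmetric (punchIn i k) i))
                                     (per-cong (λ r x → cong (A (punchIn i (punchIn k r))) (punchIn-comm i c j≢i x)))) ⟩
    ∑[ k < suc n ] (A i (punchIn i k) * per ℝ (submatrix A (punchIn i ∘ punchIn k) (punchIn i ∘ punchIn c)))
      ∎
    where
    j = punchIn i c
    j≢i = punchInᵢ≢i i c
    i′ = punchOut j≢i

  -- Expanding along row i, the terms off the diagonal form a permanent kernel quadratic form.
  diag*per-delete≤per : ∀ {n} (A : Matrix ℝ (suc n)) → PosSemidef ℝ A → ∀ i → A i i * per ℝ (delete ℝ i A) ≤ per ℝ A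
  diag*per-delete≤per {zero}  A psd zero = ≤-reflexive (sym (+-identityʳ _))
  diag*per-delete≤per {suc n} A psd@(symmetric , _) i =
    subst₂ _≤_ (+-identityʳ _) (sym per≡) (+-monoʳ-≤ _ (per-kernel-psd A psd (allFin (suc n)) S ν))
    where
    ν : Fin (suc n) → Carrier
    ν c = A i (punchIn i c)
    S : Fin (suc n) → Fin n → Fin (suc (suc n))
    S c = punchIn i ∘ punchIn c
    P : Fin (suc n) → Fin (suc n) → Carrier
    P k c = per ℝ (submatrix A (S k) (S c))
    offDiagonal : ∑[ c < suc n ] (ν c * per ℝ (minor A i (punchIn i c))) ≡ ∑∑ₗ (allFin (suc n)) (λ k c → ν k * ν c * P k c)
    offDiagonal = begin
      ∑[ c < suc n ] (ν c * per ℝ (minor A i (punchIn i c)))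
        ≡⟨ sum-cong-≗ (λ c → trans (cong (ν c *_) (per-minor-offDiagonal A symmetric i c)) (*-distribˡ-sum (ν c) (λ k → ν k * P k c))) ⟩
      ∑[ c < suc n ] ∑[ k < suc n ] (ν c * (ν k * P k c))
        ≡⟨ ∑-comm (λ c k → ν c * (ν k * P k c)) ⟩
      ∑[ k < suc n ] ∑[ c < suc n ] (ν c * (ν k * P k c))
        ≡⟨ sum-cong-≗ (λ k → sum-cong-≗ (λ c → solve 3 (λ x y z → x :* (y :* z) := y :* x :* z) refl (ν c) (ν k) (P k c))) ⟩
      ∑[ k < suc n ] ∑[ c < suc n ] (ν k * ν c * P k c)
        ≡⟨ sym (∑∑ₗ-allFin (λ k c → ν k * ν c * P k c)) ⟩
      ∑∑ₗ (allFin (suc n)) (λ k c → ν k * ν c * P k c)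
        ∎
    per≡ : per ℝ A ≡ A i i * per ℝ (delete ℝ i A) + ∑∑ₗ (allFin (suc n)) (λ k c → ν k * ν c * P k c)
    per≡ = begin
      per ℝ A                                                       ≡⟨ per-expand-row A i ⟩
      ∑[ b < suc (suc n) ] (A i b * per ℝ (minor A i b))            ≡⟨ sum-remove {i = i} (λ b → A i b * per ℝ (minor A i b)) ⟩
      A i i * per ℝ (delete ℝ i A) + ∑[ c < suc n ] (ν c * per ℝ (minor A i (punchIn i c)))
                                                                    ≡⟨ cong (A i i * per ℝ (delete ℝ i A) +_) offDiagonal ⟩
      A i i * per ℝ (delete ℝ i A) + ∑∑ₗ (allFin (suc n)) (λ k c → ν k * ν c * P k c)
                                                                    ∎

lemma4p3 : (ℝ : RealField) → let open RealField ℝ in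
    (n : ℕ) (A : Matrix ℝ (suc n)) (i : Fin (suc n)) →
    PosSemidef ℝ A →
    per ℝ (_∘ₕ_ ℝ A A) ≤ _² ℝ (per ℝ A) →
    per ℝ (_∘ₕ_ ℝ (delete ℝ i A) (delete ℝ i A)) ≤ _² ℝ (per ℝ (delete ℝ i A)) →
    (α : Carrier) → 0# ≤ α →
    let A′ = _+ₘ_ ℝ A (_·ₘ_ ℝ α (E ℝ i)) in
    per ℝ (_∘ₕ_ ℝ A′ A′) ≤ _² ℝ (per ℝ A′)
lemma4p3 ℝ n A i psd per-A∘A≤ per-A[i]∘A[i]≤ α 0≤α =
  subst₂ _≤_ (sym per-A′∘A′) (sym (cong (λ t → t * t) per-A′))
    (shifted-square-bound 0≤α (diag-nonneg psd i) (per-principal-nonneg psd (punchIn i))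
                          (diag*per-delete≤per A psd i) per-A∘A≤ per-A[i]∘A[i]≤)
  where
  open RealField ℝ
  open PermanentTheory ℝ
  A′ : Matrix ℝ (suc n)
  A′ = _+ₘ_ ℝ A (_·ₘ_ ℝ α (E ℝ i))
  per-A′ : per ℝ A′ ≡ per ℝ A + α * per ℝ (delete ℝ i A)
  per-A′ = per-shift A i α
  per-A′∘A′ : per ℝ (_∘ₕ_ ℝ A′ A′) ≡ per ℝ (_∘ₕ_ ℝ A A) + ((α + α) * A i i + α * α) * per ℝ (_∘ₕ_ ℝ (delete ℝ i A) (delete ℝ i A))
  per-A′∘A′ = trans (per-cong (hadamard-shift A i α)) (per-shift (_∘ₕ_ ℝ A A) i _)
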